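{- Let $(G,\gamma)$ be a colored graph with $n$ vertices and $2n+1$ edges. Then $(G,\gamma)$ is colored-Laman if and only if for every edge $ij$ of $G$, the colored graph $(G+(ij)_c,\gamma)$ obtained by adding a new copy $(ij)_c$ of $ij$ with the same color $\gamma_{ij}$ is a $(2,2,2)$-colored graph.
   Context: A colored graph is a finite directed multigraph (parallel edges, self-loops allowed) with colors $\gamma_{ij}\in\mathbb{Z}^2$. For a simple cycle $C$ (self-loops count) with traversal order, $\rho(C)=\sum_{ij\text{ traversed }i\to j}\gamma_{ij}-\sum_{ij\text{ traversed }j\to i}\gamma_{ij}$; $\mathrm{rk}$ is the rank of the subgroup of $\mathbb{Z}^2$ generated by all $\rho(C)$. Subgraphs are edge-induced with $n'$ vertices, $m'$ edges, $c'$ components. $(G,\gamma)$ is colored-Laman if $m=2n+1$ and every subgraph satisfies $m'\le 2n'-3+2\,\mathrm{rk}(G',\gamma)-2(c'-1)$. A colored graph on $n$ vertices is a $(2,2,2)$-colored graph if it has $2n+2$ edges and every subgraph satisfies $m'\le 2n'-2+2\,\mathrm{rk}(G',\gamma)-2(c'-1)$. -}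

module Defs where

open import Data.Nat as ℕ using (ℕ; zero; suc)
open import Data.Integer as ℤ using (ℤ; +_; 0ℤ)
open import Data.Bool using (Bool; true; false; _∧_; _∨_; if_then_else_)
open import Data.Fin using (Fin; zero; suc)
open import Data.Fin.Properties using (_≟_)
open import Data.Fin.Subset using (Subset; _∈_; ∣_∣; Nonempty)
open import Data.Vec using (tabulate; lookup)
open import Data.List using (List; []; _∷_; length; map; allFin; zipWith; foldr)
open import Data.Bool.ListAction using (any)
open import Data.List.Relation.Unary.All using (All)
open import Data.List.Relation.Unary.Any using (Any)
open import Data.List.Relation.Unary.AllPairs using (AllPairs)
open import Data.List.Relation.Unary.Linked using (Linked)
open import Data.List.Relation.Unary.Unique.Propositional using (Unique)
open import Data.Product using (Σ; ∃; _×_; _,_; proj₁; proj₂)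
open import Relation.Binary.PropositionalEquality using (_≡_)
open import Relation.Nullary using (¬_)
open import Relation.Nullary.Decidable using (isYes)

V2 : Set
V2 = ℤ × ℤ

_⊕_ : V2 → V2 → V2
(a , b) ⊕ (c , d) = (a ℤ.+ c , b ℤ.+ d)

⊖_ : V2 → V2
⊖ (a , b) = (ℤ.- a , ℤ.- b)

𝟎 : V2
𝟎 = (0ℤ , 0ℤ)

_·_ : ℤ → V2 → V2
k · (a , b) = (k ℤ.* a , k ℤ.* b)

-- Colored graphs: finite directed multigraphs on vertex set Fin n with
-- edge set Fin m (parallel edges and self-loops allowed); edge e goes
-- from (src e) to (tgt e) and has color (col e) ∈ ℤ².

record ColoredGraph (n m : ℕ) : Set where
  field
    src : Fin m → Fin n
    tgt : Fin m → Fin n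
    col : Fin m → V2

module _ {n m : ℕ} (G : ColoredGraph n m) where
  open ColoredGraph G

  -- A step of a traversal: an edge together with its traversal
  -- direction (true = traversed src → tgt, false = tgt → src).
  Step : Set
  Step = Fin m × Bool

  start : Step → Fin n
  start (e , true)  = src e
  start (e , false) = tgt e

  end : Step → Fin n
  end (e , true)  = tgt e
  end (e , false) = src e

  signedCol : Step → V2
  signedCol (e , true)  = col e
  signedCol (e , false) = ⊖ col e

  lastStep : Step → List Step → Step
  lastStep s []       = s
  lastStep s (t ∷ ts) = lastStep t ts

  -- A simple cycle (with a traversal order) in the edge-induced subgraph
  -- with edge set S: a nonempty closed trail s ∷ ss using edges of S,
  -- with pairwise distinct edges and pairwise distinct visited vertices.
  -- (Self-loops give cycles of length 1; two parallel edges give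
  -- cycles of length 2.)
  record SimpleCycle (S : Subset m) : Set where
    field
      first  : Step
      rest   : List Step
    steps : List Step
    steps = first ∷ rest
    field
      inS      : All (λ s → proj₁ s ∈ S) steps
      linked   : Linked (λ s t → end s ≡ start t) steps
      closed   : end (lastStep first rest) ≡ start first
      edgesDistinct : Unique (map proj₁ steps)
      vertsDistinct : Unique (map start steps)

  ρ : {S : Subset m} → SimpleCycle S → V2
  ρ C = foldr (λ s acc → signedCol s ⊕ acc) 𝟎 (SimpleCycle.steps C)

  data InCycleGroup (S : Subset m) : V2 → Set where
    gen  : (C : SimpleCycle S) → InCycleGroup S (ρ C)
    zero : InCycleGroup S 𝟎
    neg  : ∀ {v} → InCycleGroup S v → InCycleGroup S (⊖ v)
    add  : ∀ {v w} → InCycleGroup S v → InCycleGroup S w → InCycleGroup S (v ⊕ w)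

  vertSet : Subset m → Subset n
  vertSet S = tabulate λ v →
    any (λ e → lookup S e ∧ (isYes (src e ≟ v) ∨ isYes (tgt e ≟ v))) (allFin m)

  data Conn (S : Subset m) (u : Fin n) : Fin n → Set where
    here : Conn S u u
    fwd  : ∀ {e} → e ∈ S → Conn S u (src e) → Conn S u (tgt e)
    bwd  : ∀ {e} → e ∈ S → Conn S u (tgt e) → Conn S u (src e)

  -- c is the number of connected components of the subgraph with edge set S:
  -- there is a list of c vertices of the subgraph, pairwise in different
  -- components, such that every vertex of the subgraph is connected to one.
  IsComponentCount : Subset m → ℕ → Set
  IsComponentCount S c =
    Σ (List (Fin n)) λ reps →
      length reps ≡ c
      × All (_∈ vertSet S) reps
      × AllPairs (λ u v → ¬ Conn S u v) reps
      × (∀ v → v ∈ vertSet S → Any (Conn S v) reps)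


linComb : List ℤ → List V2 → V2
linComb cs vs = foldr _⊕_ 𝟎 (zipWith _·_ cs vs)

LinIndep : List V2 → Set
LinIndep vs = ∀ (cs : List ℤ) → length cs ≡ length vs →
  linComb cs vs ≡ 𝟎 → All (_≡ 0ℤ) cs

-- r is the rank of the subgroup H of ℤ² (given by a membership predicate):
-- the maximal number of ℤ-linearly independent elements of H.
IsRank : (V2 → Set) → ℕ → Set
IsRank H r =
  (Σ (List V2) λ vs → length vs ≡ r × All H vs × LinIndep vs)
  × (∀ vs → All H vs → LinIndep vs → length vs ℕ.≤ r)

module _ {n m : ℕ} (G : ColoredGraph n m) where

  Sparse : ℤ → Set
  Sparse k = ∀ (S : Subset m) → Nonempty S → ∀ (r c : ℕ) →
    IsRank (InCycleGroup G S) r → IsComponentCount G S c →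
    + ∣ S ∣ ℤ.≤ (+ 2) ℤ.* (+ ∣ vertSet G S ∣) ℤ.+ k ℤ.+ (+ 2) ℤ.* (+ r)
                 ℤ.- (+ 2) ℤ.* ((+ c) ℤ.- (+ 1))

  ColoredLaman : Set
  ColoredLaman = m ≡ 2 ℕ.* n ℕ.+ 1 × Sparse (ℤ.- (+ 3))

  Colored222 : Set
  Colored222 = m ≡ 2 ℕ.* n ℕ.+ 2 × Sparse (ℤ.- (+ 2))

-- G + (ij)_c : add a new copy (as edge `zero`) of edge e, same color.
addCopy : ∀ {n m} → ColoredGraph n m → Fin m → ColoredGraph n (suc m)
addCopy G e = record { src = s ; tgt = t ; col = c }
  where
  open ColoredGraph G
  s : Fin _ → Fin _
  s zero = src e
  s (suc f) = src f
  t : Fin _ → Fin _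
  t zero = tgt e
  t (suc f) = tgt f
  c : Fin _ → V2
  c zero = col e
  c (suc f) = col f

module Submission where

-- Both sparsity conditions only look at a subgraph through its number of edges,
-- its vertex set, its cycle group and its connectivity.  We call two subgraphs
-- equivalent when edge maps preserving endpoints and colors run both ways and
-- every simple cycle of one contributes its ρ to the cycle group of the other;
-- equivalent subgraphs then have the same rank, component count and vertex
-- count, hence the same sparsity budget.  The only cycle that does not map
-- through the projection G + (ij)_c → G is the 2-cycle formed by ij and its copy,
-- and its ρ vanishes.  So every subgraph of G + (ij)_c is equivalent to a
-- subgraph of G with at most one edge less (T ↦ T or T ∪ {ij}), which gives the
-- forward direction, and a subgraph S of G containing ij is equivalent to S
-- together with the copy, which gives the converse.  The budgets with constants
-- −3 and −2 differ by exactly one, and that absorbs the extra edge.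

open import Defs
open import Data.Nat using (ℕ; _+_; _*_; zero; suc; s≤s)
import Data.Nat as ℕ
import Data.Nat.Properties as ℕP
open import Data.Integer using (ℤ; +_; +≤+)
import Data.Integer as ℤ
import Data.Integer.Properties as ℤP
open import Data.Integer.Tactic.RingSolver using (solve-∀)
open import Data.Bool using (true; false; T; _∧_; _∨_)
open import Data.Bool.Properties using (T-∧; T-∨; T-≡)
open import Data.Bool.ListAction using (any)
open import Data.Fin using (Fin; zero; suc)
open import Data.Fin.Properties using (_≟_; suc-injective)
open import Data.Fin.Subset using (Subset; _∈_; _∉_; _⊆_; _∪_; ⁅_⁆; ∣_∣; Nonempty)
open import Data.Fin.Subset.Properties
  using (⊆-antisym; p⊆p∪q; q⊆p∪q; x∈p∪q⁻; x∈⁅x⁆; x∈⁅y⁆⇒x≡y; ∣p∣≤∣p∪q∣)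
open import Data.Vec using (_∷_; lookup)
open import Data.Vec.Base using (here; there)
open import Data.Vec.Properties using ([]=↔lookup; lookup∘tabulate)
open import Data.List using (List; []; _∷_; _++_; map; foldr; allFin)
import Data.List.Membership.Propositional as List
open import Data.List.Membership.Propositional.Properties using (∈-allFin; ∈-map⁺; ∈-map⁻; ∈-++⁺ʳ)
open import Data.List.Properties using (map-∘; map-cong)
open import Data.List.Relation.Unary.All as All using (All; []; _∷_)
import Data.List.Relation.Unary.All.Properties as All
open import Data.List.Relation.Unary.Any as Any using (Any; here; there)
open import Data.List.Relation.Unary.Any.Properties using (any⁺; any⁻)
open import Data.List.Relation.Unary.AllPairs as AllPairs using (AllPairs; []; _∷_)
open import Data.List.Relation.Unary.Linked as Linked using (Linked; _∷_)
import Data.List.Relation.Unary.Linked.Properties as Linked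
open import Data.List.Relation.Unary.Unique.Propositional using (Unique)
open import Data.Product using (∃-syntax; _×_; _,_; proj₁; proj₂)
open import Data.Sum as Sum using (_⊎_; inj₁; inj₂)
open import Data.Empty using (⊥-elim)
open import Function.Bundles using (_⇔_; mk⇔; Equivalence; Inverse)
open import Relation.Binary.PropositionalEquality
open import Relation.Nullary using (¬_; yes; no; _×-dec_)
open import Relation.Nullary.Decidable using (isYes; toWitness; fromWitness)
import Data.List.Membership.DecPropositional as DecMembership

⊕-cancelʳ : ∀ x → x ⊕ ((⊖ x) ⊕ 𝟎) ≡ 𝟎
⊕-cancelʳ (a , b) = cong₂ _,_ (cancel a) (cancel b)
  where
  cancel : ∀ a → a ℤ.+ (ℤ.- a ℤ.+ ℤ.0ℤ) ≡ ℤ.0ℤ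
  cancel = solve-∀

⊕-cancelˡ : ∀ x → (⊖ x) ⊕ (x ⊕ 𝟎) ≡ 𝟎
⊕-cancelˡ (a , b) = cong₂ _,_ (cancel a) (cancel b)
  where
  cancel : ∀ a → ℤ.- a ℤ.+ (a ℤ.+ ℤ.0ℤ) ≡ ℤ.0ℤ
  cancel = solve-∀

InjectiveOn : {A B : Set} → (A → B) → List A → Set
InjectiveOn f xs = ∀ {x y} → x List.∈ xs → y List.∈ xs → f x ≡ f y → x ≡ y

unique-map : {A B : Set} (f : A → B) (xs : List A) →
  InjectiveOn f xs → Unique xs → Unique (map f xs)
unique-map f [] inj [] = []
unique-map f (x ∷ xs) inj (x∉xs ∷ xs!) =
  distinct xs (λ y∈ → inj (here refl) (there y∈)) x∉xs
    ∷ unique-map f xs (λ x∈ y∈ → inj (there x∈) (there y∈)) xs!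
  where
  distinct : ∀ ys → (∀ {y} → y List.∈ ys → f x ≡ f y → x ≡ y) →
    All (x ≢_) ys → All (f x ≢_) (map f ys)
  distinct [] _ [] = []
  distinct (y ∷ ys) inj′ (x≢y ∷ x∉ys) =
    (λ fx≡fy → x≢y (inj′ (here refl) fx≡fy)) ∷ distinct ys (λ y∈ → inj′ (there y∈)) x∉ys

split-pair : {A : Set} {R : A → A → Set} →
  (∀ {x y} → R x y → R y x) → (∀ {x} → ¬ R x x) →
  ∀ {x y} (xs : List A) → x List.∈ xs → y List.∈ xs → R x y →
  ∃[ P ] ∃[ a ] ∃[ Q ] ∃[ b ] xs ≡ P ++ a ∷ Q × b List.∈ Q × R a b
split-pair sym irr (z ∷ xs) (here refl) (here refl) r = ⊥-elim (irr r)
split-pair sym irr (z ∷ xs) (here refl) (there y∈) r = [] , z , xs , _ , refl , y∈ , r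
split-pair sym irr (z ∷ xs) (there x∈) (here refl) r = [] , z , xs , _ , refl , x∈ , sym r
split-pair sym irr (z ∷ xs) (there x∈) (there y∈) r with split-pair sym irr xs x∈ y∈ r
... | P , a , Q , b , refl , b∈ , rab = z ∷ P , a , Q , b , refl , b∈ , rab

∈⇒T : ∀ {k} {p : Subset k} {x} → x ∈ p → T (lookup p x)
∈⇒T x∈p = Equivalence.from T-≡ (Inverse.to []=↔lookup x∈p)

T⇒∈ : ∀ {k} {p : Subset k} {x} → T (lookup p x) → x ∈ p
T⇒∈ t = Inverse.from []=↔lookup (Equivalence.to T-≡ t)

module _ {n m : ℕ} (G : ColoredGraph n m) where
  open ColoredGraph G

  Incident : Fin m → Fin n → Set
  Incident f v = src f ≡ v ⊎ tgt f ≡ v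

  incidence-test : ∀ {S f v} →
    T (lookup S f ∧ (isYes (src f ≟ v) ∨ isYes (tgt f ≟ v))) ⇔ (f ∈ S × Incident f v)
  incidence-test {S} {f} {v} = mk⇔ to from
    where
    to : _ → _
    to t with Equivalence.to (T-∧ {lookup S f}) t
    ... | f∈ , inc = T⇒∈ f∈ , Sum.map (toWitness {a? = src f ≟ v}) (toWitness {a? = tgt f ≟ v})
                                       (Equivalence.to (T-∨ {isYes (src f ≟ v)}) inc)
    from : _ → _
    from (f∈ , inc) = Equivalence.from (T-∧ {lookup S f})
      (∈⇒T f∈ , Equivalence.from (T-∨ {isYes (src f ≟ v)})
                  (Sum.map (fromWitness {a? = src f ≟ v}) (fromWitness {a? = tgt f ≟ v}) inc))

  vertSet-intro : ∀ {S f v} → f ∈ S → Incident f v → v ∈ vertSet G S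
  vertSet-intro {S} {f} {v} f∈ inc = T⇒∈ (subst T (sym (lookup∘tabulate _ v))
    (any⁺ _ (Any.map (λ { refl → Equivalence.from incidence-test (f∈ , inc) }) (∈-allFin f))))

  vertSet-elim : ∀ {S v} → v ∈ vertSet G S → ∃[ f ] f ∈ S × Incident f v
  vertSet-elim {S} {v} v∈ =
    let (f , t) = Any.satisfied (any⁻ _ (allFin m) (subst T (lookup∘tabulate _ v) (∈⇒T v∈)))
    in f , Equivalence.to incidence-test t

  edges : ∀ {S} → SimpleCycle G S → List (Fin m)
  edges C = map proj₁ (SimpleCycle.steps C)

  colorSum : List (Step G) → V2
  colorSum = foldr (λ s acc → signedCol G s ⊕ acc) 𝟎

  edges⊆ : ∀ {S} (C : SimpleCycle G S) {f} → f List.∈ edges C → f ∈ S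
  edges⊆ C f∈ with ∈-map⁻ proj₁ f∈
  ... | s , s∈ , refl = All.lookup (SimpleCycle.inS C) s∈

module _ {n m : ℕ} (G : ColoredGraph n m) where
  open ColoredGraph G

  record Twins (f g : Fin m) : Set where
    field
      distinct : f ≢ g
      same-src : src f ≡ src g
      same-tgt : tgt f ≡ tgt g
      same-col : col f ≡ col g

  twins-sym : ∀ {f g} → Twins f g → Twins g f
  twins-sym t = record { distinct = λ eq → distinct (sym eq) ; same-src = sym same-src
                       ; same-tgt = sym same-tgt ; same-col = sym same-col }
    where open Twins t

  Consecutive : Step G → Step G → Set
  Consecutive s t = end G s ≡ start G t

  opposite-twins : ∀ a b → Twins (proj₁ a) (proj₁ b) → start G a ≢ start G b →
    Consecutive a b × Consecutive b a × signedCol G a ⊕ (signedCol G b ⊕ 𝟎) ≡ 𝟎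
  opposite-twins (f , true)  (g , true)  t ne = ⊥-elim (ne (Twins.same-src t))
  opposite-twins (f , false) (g , false) t ne = ⊥-elim (ne (Twins.same-tgt t))
  opposite-twins (f , true)  (g , false) t ne =
    Twins.same-tgt t , sym (Twins.same-src t) ,
    trans (cong (λ x → x ⊕ ((⊖ col g) ⊕ 𝟎)) (Twins.same-col t)) (⊕-cancelʳ (col g))
  opposite-twins (f , false) (g , true)  t ne =
    Twins.same-src t , sym (Twins.same-tgt t) ,
    trans (cong (λ x → (⊖ x) ⊕ (col g ⊕ 𝟎)) (Twins.same-col t)) (⊕-cancelˡ (col g))

  returns-immediately : ∀ {a b} Q → Linked Consecutive (a ∷ Q) →
    Unique (map (start G) (a ∷ Q)) → b List.∈ Q →
    Consecutive a b → Consecutive b a → Q ≡ b ∷ []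
  returns-immediately (q ∷ []) _ _ (here refl) _ _ = refl
  returns-immediately (q ∷ q′ ∷ Q) (_ ∷ q→q′ ∷ _) ((_ ∷ a≢q′ ∷ _) ∷ _) (here refl) _ b→a =
    ⊥-elim (a≢q′ (trans (sym b→a) q→q′))
  returns-immediately (q ∷ Q) (a→q ∷ _) (_ ∷ (q∉Q ∷ _)) (there b∈Q) a→b _ =
    ⊥-elim (All.lookup q∉Q (∈-map⁺ (start G) b∈Q) (trans (sym a→q) a→b))

  linked-suffix : ∀ P {ys} → Linked Consecutive (P ++ ys) → Linked Consecutive ys
  linked-suffix [] l = l
  linked-suffix (x ∷ P) l = linked-suffix P (Linked.tail l)

  unique-suffix : ∀ P {ys} → Unique (map (start G) (P ++ ys)) → Unique (map (start G) ys)
  unique-suffix [] u = u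
  unique-suffix (x ∷ P) (_ ∷ u) = unique-suffix P u

  lastStep-++ : ∀ p P a Q → lastStep G p (P ++ a ∷ Q) ≡ lastStep G a Q
  lastStep-++ p [] a Q = refl
  lastStep-++ p (x ∷ P) a Q = lastStep-++ x P a Q

  -- A simple cycle in which a step a is later followed by a step b with
  -- a → b → a consists of a and b only: b follows a immediately and ends the
  -- list, and any step p before a would start where b ends, i.e. at start a.
  two-step-cycle : ∀ {S} (C : SimpleCycle G S) → let open SimpleCycle C in
    ∀ P a Q {b} → steps ≡ P ++ a ∷ Q → b List.∈ Q →
    Consecutive a b → Consecutive b a → steps ≡ a ∷ b ∷ []
  two-step-cycle C [] a Q refl b∈Q a→b b→a =
    cong (a ∷_) (returns-immediately Q linked vertsDistinct b∈Q a→b b→a)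
    where open SimpleCycle C
  two-step-cycle C (p ∷ P) a Q eq b∈Q a→b b→a with C | eq
  ... | record { linked = l ; closed = cl ; vertsDistinct = p∉ ∷ u } | refl
    with returns-immediately Q (linked-suffix P (Linked.tail l)) (unique-suffix P u) b∈Q a→b b→a
  ... | refl = ⊥-elim (All.lookup p∉ (∈-map⁺ (start G) (∈-++⁺ʳ P (here refl)))
                 (trans (sym (trans (cong (end G) (sym (lastStep-++ p P a (_ ∷ [])))) cl)) b→a))

  twins-cycle-ρ : ∀ {S} (C : SimpleCycle G S) {f g} → Twins f g →
    f List.∈ edges G C → g List.∈ edges G C → ρ G C ≡ 𝟎
  twins-cycle-ρ C tw f∈ g∈ with ∈-map⁻ proj₁ f∈ | ∈-map⁻ proj₁ g∈
  ... | s , s∈ , refl | t , t∈ , refl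
    with split-pair twins-sym (λ t → Twins.distinct t refl) (SimpleCycle.steps C) s∈ t∈ tw
  ... | P , a , Q , b , eq , b∈Q , ab
    with unique-suffix P (subst (λ L → Unique (map (start G) L)) eq (SimpleCycle.vertsDistinct C))
  ... | a∉Q ∷ _ with opposite-twins a b ab (All.lookup a∉Q (∈-map⁺ (start G) b∈Q))
  ... | a→b , b→a , cancel = trans (cong (colorSum G) (two-step-cycle C P a Q eq b∈Q a→b b→a)) cancel

record SubgraphMap {n m₁ m₂ : ℕ} (G₁ : ColoredGraph n m₁) (S₁ : Subset m₁)
                   (G₂ : ColoredGraph n m₂) (S₂ : Subset m₂) : Set where
  field
    edge     : Fin m₁ → Fin m₂
    src-edge : ∀ f → ColoredGraph.src G₂ (edge f) ≡ ColoredGraph.src G₁ f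
    tgt-edge : ∀ f → ColoredGraph.tgt G₂ (edge f) ≡ ColoredGraph.tgt G₁ f
    col-edge : ∀ f → ColoredGraph.col G₂ (edge f) ≡ ColoredGraph.col G₁ f
    ∈-edge   : ∀ {f} → f ∈ S₁ → edge f ∈ S₂

module _ {n m₁ m₂ : ℕ} {G₁ : ColoredGraph n m₁} {S₁ : Subset m₁}
         {G₂ : ColoredGraph n m₂} {S₂ : Subset m₂} (h : SubgraphMap G₁ S₁ G₂ S₂) where
  open SubgraphMap h

  conn-image : ∀ {u v} → Conn G₁ S₁ u v → Conn G₂ S₂ u v
  conn-image here = here
  conn-image (fwd {f} f∈ c) =
    subst (Conn G₂ S₂ _) (tgt-edge f) (fwd (∈-edge f∈) (subst (Conn G₂ S₂ _) (sym (src-edge f)) (conn-image c)))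
  conn-image (bwd {f} f∈ c) =
    subst (Conn G₂ S₂ _) (src-edge f) (bwd (∈-edge f∈) (subst (Conn G₂ S₂ _) (sym (tgt-edge f)) (conn-image c)))

  vertSet-image : vertSet G₁ S₁ ⊆ vertSet G₂ S₂
  vertSet-image v∈ with vertSet-elim G₁ v∈
  ... | f , f∈ , inj₁ p = vertSet-intro G₂ (∈-edge f∈) (inj₁ (trans (src-edge f) p))
  ... | f , f∈ , inj₂ p = vertSet-intro G₂ (∈-edge f∈) (inj₂ (trans (tgt-edge f) p))

  step-image : Step G₁ → Step G₂
  step-image (f , dir) = edge f , dir

  start-image : ∀ s → start G₂ (step-image s) ≡ start G₁ s
  start-image (f , true)  = src-edge f
  start-image (f , false) = tgt-edge f

  end-image : ∀ s → end G₂ (step-image s) ≡ end G₁ s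
  end-image (f , true)  = tgt-edge f
  end-image (f , false) = src-edge f

  colorSum-image : ∀ xs → colorSum G₂ (map step-image xs) ≡ colorSum G₁ xs
  colorSum-image [] = refl
  colorSum-image ((f , true) ∷ xs)  = cong₂ _⊕_ (col-edge f) (colorSum-image xs)
  colorSum-image ((f , false) ∷ xs) = cong₂ _⊕_ (cong ⊖_ (col-edge f)) (colorSum-image xs)

  lastStep-image : ∀ s ts → lastStep G₂ (step-image s) (map step-image ts) ≡ step-image (lastStep G₁ s ts)
  lastStep-image s [] = refl
  lastStep-image s (t ∷ ts) = lastStep-image t ts

  cycle-image : (C : SimpleCycle G₁ S₁) → InjectiveOn edge (edges G₁ C) →
    InCycleGroup G₂ S₂ (ρ G₁ C)
  cycle-image C inj = subst (InCycleGroup G₂ S₂) (colorSum-image steps) (gen C′)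
    where
    open SimpleCycle C
    C′ : SimpleCycle G₂ S₂
    C′ = record
      { first = step-image first
      ; rest = map step-image rest
      ; inS = All.map⁺ (All.map ∈-edge inS)
      ; linked = Linked.map⁺ (Linked.map (λ {s} {t} s→t →
                   trans (end-image s) (trans s→t (sym (start-image t)))) linked)
      ; closed = trans (cong (end G₂) (lastStep-image first rest))
                   (trans (end-image (lastStep G₁ first rest)) (trans closed (sym (start-image first))))
      ; edgesDistinct = subst Unique (trans (sym (map-∘ {g = edge} {f = proj₁} steps)) (map-∘ {g = proj₁} {f = step-image} steps))
                          (unique-map edge (edges G₁ C) inj edgesDistinct)
      ; vertsDistinct = subst Unique (sym (trans (sym (map-∘ steps)) (map-cong start-image steps)))
                          vertsDistinct
      }

record SubgraphEquiv {n m₁ m₂ : ℕ} (G₁ : ColoredGraph n m₁) (S₁ : Subset m₁)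
                     (G₂ : ColoredGraph n m₂) (S₂ : Subset m₂) : Set where
  field
    forth        : SubgraphMap G₁ S₁ G₂ S₂
    back         : SubgraphMap G₂ S₂ G₁ S₁
    forth-cycles : (C : SimpleCycle G₁ S₁) → InCycleGroup G₂ S₂ (ρ G₁ C)
    back-cycles  : (C : SimpleCycle G₂ S₂) → InCycleGroup G₁ S₁ (ρ G₂ C)

module _ {n m₁ m₂ : ℕ} {G₁ : ColoredGraph n m₁} {S₁ : Subset m₁}
         {G₂ : ColoredGraph n m₂} {S₂ : Subset m₂} (E : SubgraphEquiv G₁ S₁ G₂ S₂) where
  open SubgraphEquiv E

  equiv-sym : SubgraphEquiv G₂ S₂ G₁ S₁
  equiv-sym = record { forth = back ; back = forth ; forth-cycles = back-cycles ; back-cycles = forth-cycles }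

  group-image : ∀ {v} → InCycleGroup G₁ S₁ v → InCycleGroup G₂ S₂ v
  group-image (gen C) = forth-cycles C
  group-image zero = zero
  group-image (neg x) = neg (group-image x)
  group-image (add x y) = add (group-image x) (group-image y)

  vertSet-equiv : vertSet G₁ S₁ ≡ vertSet G₂ S₂
  vertSet-equiv = ⊆-antisym (vertSet-image forth) (vertSet-image back)

module _ {n m₁ m₂ : ℕ} {G₁ : ColoredGraph n m₁} {S₁ : Subset m₁}
         {G₂ : ColoredGraph n m₂} {S₂ : Subset m₂} (E : SubgraphEquiv G₁ S₁ G₂ S₂) where
  open SubgraphEquiv E

  rank-transfer : ∀ {r} → IsRank (InCycleGroup G₁ S₁) r → IsRank (InCycleGroup G₂ S₂) r
  rank-transfer ((vs , len , inH , indep) , maximal) =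
    (vs , len , All.map (group-image E) inH , indep) ,
    λ ws inH′ indep′ → maximal ws (All.map (group-image (equiv-sym E)) inH′) indep′

  components-transfer : ∀ {c} → IsComponentCount G₁ S₁ c → IsComponentCount G₂ S₂ c
  components-transfer (reps , len , inV , apart , cover) =
    reps , len , All.map (subst (_ ∈_) (vertSet-equiv E)) inV ,
    AllPairs.map (λ u≁v u~v → u≁v (conn-image back u~v)) apart ,
    λ v v∈ → Any.map (conn-image forth) (cover v (subst (v ∈_) (sym (vertSet-equiv E)) v∈))

budget : {n : ℕ} → Subset n → ℤ → ℕ → ℕ → ℤ
budget V k r c = (+ 2) ℤ.* (+ ∣ V ∣) ℤ.+ k ℤ.+ (+ 2) ℤ.* (+ r) ℤ.- (+ 2) ℤ.* ((+ c) ℤ.- (+ 1))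

Bounded : {n m : ℕ} → ColoredGraph n m → Subset m → ℤ → ℕ → Set
Bounded G S k x = ∀ (r c : ℕ) → IsRank (InCycleGroup G S) r → IsComponentCount G S c →
  + x ℤ.≤ budget (vertSet G S) k r c

bounded-transfer : ∀ {n m₁ m₂} {G₁ : ColoredGraph n m₁} {S₁} {G₂ : ColoredGraph n m₂} {S₂} →
  SubgraphEquiv G₁ S₁ G₂ S₂ → ∀ {k x} → Bounded G₁ S₁ k x → Bounded G₂ S₂ k x
bounded-transfer E {k} {x} b r c rk cc =
  subst (λ V → + x ℤ.≤ budget V k r c) (vertSet-equiv E)
    (b r c (rank-transfer (equiv-sym E) rk) (components-transfer (equiv-sym E) cc))

bounded-mono : ∀ {n m} {G : ColoredGraph n m} {S k x y} → x ℕ.≤ y → Bounded G S k y → Bounded G S k x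
bounded-mono x≤y b r c rk cc = ℤP.≤-trans (+≤+ x≤y) (b r c rk cc)

budget-step : ∀ {n} (V : Subset n) r c → budget V (ℤ.- (+ 2)) r c ≡ + 1 ℤ.+ budget V (ℤ.- (+ 3)) r c
budget-step V r c = shift ((+ 2) ℤ.* (+ ∣ V ∣)) ((+ 2) ℤ.* (+ r)) ((+ 2) ℤ.* ((+ c) ℤ.- (+ 1)))
  where
  shift : ∀ X Y Z → X ℤ.+ ℤ.- (+ 2) ℤ.+ Y ℤ.- Z ≡ + 1 ℤ.+ (X ℤ.+ ℤ.- (+ 3) ℤ.+ Y ℤ.- Z)
  shift = solve-∀

bounded-shift : ∀ {n m} {G : ColoredGraph n m} {S x} →
  Bounded G S (ℤ.- (+ 3)) x → Bounded G S (ℤ.- (+ 2)) (suc x)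
bounded-shift {G = G} {S} b r c rk cc =
  subst (+ suc _ ℤ.≤_) (sym (budget-step (vertSet G S) r c)) (ℤP.+-monoʳ-≤ (+ 1) (b r c rk cc))

bounded-unshift : ∀ {n m} {G : ColoredGraph n m} {S x} →
  Bounded G S (ℤ.- (+ 2)) (suc x) → Bounded G S (ℤ.- (+ 3)) x
bounded-unshift {G = G} {S} b r c rk cc =
  subst (+ _ ℤ.≤_) (predecessor _)
    (ℤP.+-monoʳ-≤ (ℤ.- (+ 1)) (subst (+ suc _ ℤ.≤_) (budget-step (vertSet G S) r c) (b r c rk cc)))
  where
  predecessor : ∀ B → ℤ.- (+ 1) ℤ.+ (+ 1 ℤ.+ B) ≡ B
  predecessor = solve-∀

-- In addCopy G e the new edge is `zero` and every old edge f becomes `suc f`.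
module WithCopy {n m : ℕ} (G : ColoredGraph n m) (e : Fin m) where
  open ColoredGraph G

  G⁺ : ColoredGraph n (suc m)
  G⁺ = addCopy G e

  copy-twins : Twins G⁺ zero (suc e)
  copy-twins = record { distinct = λ () ; same-src = refl ; same-tgt = refl ; same-col = refl }

  original : Fin (suc m) → Fin m
  original zero = e
  original (suc f) = f

  project : ∀ {T S} → (∀ {f} → f ∈ T → original f ∈ S) → SubgraphMap G⁺ T G S
  project ∈-original = record { edge = original ; src-edge = src-original ; tgt-edge = tgt-original
                              ; col-edge = col-original ; ∈-edge = ∈-original }
    where
    src-original : ∀ f → src (original f) ≡ ColoredGraph.src G⁺ f
    src-original zero = refl
    src-original (suc f) = refl
    tgt-original : ∀ f → tgt (original f) ≡ ColoredGraph.tgt G⁺ f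
    tgt-original zero = refl
    tgt-original (suc f) = refl
    col-original : ∀ f → col (original f) ≡ ColoredGraph.col G⁺ f
    col-original zero = refl
    col-original (suc f) = refl

  original-injective : ∀ L → ¬ (zero List.∈ L × suc e List.∈ L) → InjectiveOn original L
  original-injective L ¬both {zero} {zero} _ _ _ = refl
  original-injective L ¬both {suc f} {suc g} _ _ eq = cong suc eq
  original-injective L ¬both {zero} {suc g} z∈ s∈ refl = ⊥-elim (¬both (z∈ , s∈))
  original-injective L ¬both {suc f} {zero} s∈ z∈ refl = ⊥-elim (¬both (z∈ , s∈))

  include : ∀ b T → SubgraphMap G T G⁺ (b ∷ T)
  include b T = record { edge = suc ; src-edge = λ _ → refl ; tgt-edge = λ _ → refl
                       ; col-edge = λ _ → refl ; ∈-edge = there }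

  redirect : Fin m → Fin (suc m)
  redirect f with f ≟ e
  ... | yes _ = zero
  ... | no _ = suc f

  redirect-map : ∀ {S T} → (∀ {f} → f ∈ S → f ≡ e ⊎ f ∈ T) → SubgraphMap G S G⁺ (true ∷ T)
  redirect-map {S} {T} split = record { edge = redirect ; src-edge = src-redirect ; tgt-edge = tgt-redirect
                                      ; col-edge = col-redirect ; ∈-edge = ∈-redirect }
    where
    src-redirect : ∀ f → ColoredGraph.src G⁺ (redirect f) ≡ src f
    src-redirect f with f ≟ e
    ... | yes refl = refl
    ... | no _ = refl
    tgt-redirect : ∀ f → ColoredGraph.tgt G⁺ (redirect f) ≡ tgt f
    tgt-redirect f with f ≟ e
    ... | yes refl = refl
    ... | no _ = refl
    col-redirect : ∀ f → ColoredGraph.col G⁺ (redirect f) ≡ col f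
    col-redirect f with f ≟ e
    ... | yes refl = refl
    ... | no _ = refl
    ∈-redirect : ∀ {f} → f ∈ S → redirect f ∈ true ∷ T
    ∈-redirect {f} f∈ with f ≟ e | split f∈
    ... | yes _ | _ = here
    ... | no f≢e | inj₁ f≡e = ⊥-elim (f≢e f≡e)
    ... | no _ | inj₂ f∈T = there f∈T

  redirect-injective : ∀ {f g} → redirect f ≡ redirect g → f ≡ g
  redirect-injective {f} {g} eq with f ≟ e | g ≟ e
  ... | yes f≡e | yes g≡e = trans f≡e (sym g≡e)
  ... | no _ | no _ = suc-injective eq

  without-copy : ∀ T → SubgraphEquiv G T G⁺ (false ∷ T)
  without-copy T = record
    { forth = include false T
    ; back = project ∈-original
    ; forth-cycles = λ C → cycle-image (include false T) C (λ _ _ → suc-injective)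
    ; back-cycles = λ C → cycle-image (project ∈-original) C
        (original-injective (edges G⁺ C) (λ { (z∈ , _) → absent (edges⊆ G⁺ C z∈) }))
    }
    where
    ∈-original : ∀ {f} → f ∈ false ∷ T → original f ∈ T
    ∈-original (there f∈) = f∈
    absent : zero ∉ false ∷ T
    absent ()

  -- The
  -- 2-cycle formed by ij and its copy has ρ = 0, so it does not enlarge
  -- the cycle group.
  with-copy : ∀ {S T} → e ∈ S → T ⊆ S → (∀ {f} → f ∈ S → f ≡ e ⊎ f ∈ T) →
    SubgraphEquiv G S G⁺ (true ∷ T)
  with-copy {S} {T} e∈S T⊆S split = record
    { forth = redirect-map split
    ; back = project ∈-original
    ; forth-cycles = λ C → cycle-image (redirect-map split) C (λ _ _ → redirect-injective)
    ; back-cycles = back-cycles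
    }
    where
    ∈-original : ∀ {f} → f ∈ true ∷ T → original f ∈ S
    ∈-original here = e∈S
    ∈-original (there f∈) = T⊆S f∈
    open DecMembership (_≟_ {suc m}) using (_∈?_)
    back-cycles : (C : SimpleCycle G⁺ (true ∷ T)) → InCycleGroup G S (ρ G⁺ C)
    back-cycles C with (zero ∈? edges G⁺ C) ×-dec (suc e ∈? edges G⁺ C)
    ... | yes (z∈ , s∈) = subst (InCycleGroup G S) (sym (twins-cycle-ρ G⁺ C copy-twins z∈ s∈)) zero
    ... | no ¬both = cycle-image (project ∈-original) C (original-injective (edges G⁺ C) ¬both)

  reduce : ∀ T′ → Nonempty T′ →
    ∃[ S ] Nonempty S × SubgraphEquiv G S G⁺ T′ × ∣ T′ ∣ ℕ.≤ suc ∣ S ∣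
  reduce (false ∷ T) (suc f , there f∈) = T , (f , f∈) , without-copy T , ℕP.n≤1+n ∣ T ∣
  reduce (true ∷ T) _ =
    T ∪ ⁅ e ⁆ , (e , e∈) ,
    with-copy e∈ (p⊆p∪q ⁅ e ⁆) (λ f∈ → Sum.swap (Sum.map₂ (x∈⁅y⁆⇒x≡y e) (x∈p∪q⁻ T ⁅ e ⁆ f∈))) ,
    s≤s (∣p∣≤∣p∪q∣ T ⁅ e ⁆)
    where
    e∈ : e ∈ T ∪ ⁅ e ⁆
    e∈ = q⊆p∪q T ⁅ e ⁆ (x∈⁅x⁆ e)

  add-copy : ∀ {S} → e ∈ S → SubgraphEquiv G S G⁺ (true ∷ S)
  add-copy e∈S = with-copy e∈S (λ f∈ → f∈) inj₂

lemma20 : ∀ (n m : ℕ) (G : ColoredGraph n m) → m ≡ 2 * n + 1 →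
    (ColoredLaman G → ∀ (e : Fin m) → Colored222 (addCopy G e))
    × ((∀ (e : Fin m) → Colored222 (addCopy G e)) → ColoredLaman G)
lemma20 n m G m≡2n+1 = laman⇒copies , copies⇒laman
  where
  laman⇒copies : ColoredLaman G → ∀ e → Colored222 (addCopy G e)
  laman⇒copies (_ , sparse) e =
    trans (cong suc m≡2n+1) (sym (ℕP.+-suc (2 * n) 1)) , sparse⁺
    where
    open WithCopy G e
    sparse⁺ : Sparse G⁺ (ℤ.- (+ 2))
    sparse⁺ T′ ne with reduce T′ ne
    ... | S , neS , S≃T′ , card =
      bounded-mono card (bounded-shift (bounded-transfer S≃T′ (sparse S neS)))

  copies⇒laman : (∀ e → Colored222 (addCopy G e)) → ColoredLaman G
  copies⇒laman sparse⁺ = m≡2n+1 , sparse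
    where
    sparse : Sparse G (ℤ.- (+ 3))
    sparse S (e , e∈S) =
      bounded-unshift (bounded-transfer (equiv-sym (WithCopy.add-copy G e e∈S))
                         (proj₂ (sparse⁺ e) (true ∷ S) (zero , here)))
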